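{- Let $f:\{0,1\}^n\to\{0,1\}$ be a monotone Boolean function which is sensitive on all its inputs, and let $C$ be a circuit of depth $d$ computing $f$ such that each internal gate of $C$ computes a Boolean function having an orientation of weight at most $w$. Then $d\cdot(4w+1)\ge \mathrm{KW}^+(f)$.
   Context: Circuits have $\land,\lor$ gates of fan-in at most two and $\neg$ gates. $f$ is sensitive on input $i$ if there is $x$ with $f(x)\ne f(x\oplus e_i)$. A function $g:\{0,1\}^n\to\{0,1\}$ has orientation $\beta$ if there is a monotone $h:\{0,1\}^{2n}\to\{0,1\}$ with $g(x)=h(x,x\oplus\beta)$ for all $x$; its weight is the number of ones of $\beta$. $\mathrm{KW}^+(f)$ is the deterministic communication complexity of the game in which Alice gets $x\in f^{ -1}(1)$, Bob gets $y\in f^{ -1}(0)$, and they must agree on an index $i$ with $x_i=1$, $y_i=0$. -}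

module Defs where

open import Data.Bool using (Bool; true; false; not; _xor_; if_then_else_) renaming (_≤_ to _≤ᵇ_)
open import Data.Nat using (ℕ; zero; suc; _+_; _⊔_)
open import Data.Fin using (Fin; _≟_)
open import Data.List using (List; map; allFin)
open import Data.Nat.ListAction using (sum)
open import Data.Vec.Functional using (_++_)
open import Data.Product using (Σ; _×_; ∃)
open import Data.Unit using (⊤)
open import Relation.Nullary using (¬_)
open import Relation.Nullary.Decidable using (⌊_⌋)
open import Relation.Binary.PropositionalEquality using (_≡_)

BVec : ℕ → Set
BVec n = Fin n → Bool

BoolFun : ℕ → Set
BoolFun n = BVec n → Bool

Monotone : ∀ {n} → BoolFun n → Set
Monotone {n} f = (x y : BVec n) → (∀ i → x i ≤ᵇ y i) → f x ≤ᵇ f y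

flipAt : ∀ {n} → Fin n → BVec n → BVec n
flipAt i x j = if ⌊ j ≟ i ⌋ then not (x j) else x j

SensitiveOn : ∀ {n} → BoolFun n → Fin n → Set
SensitiveOn f i = ∃ λ x → ¬ (f x ≡ f (flipAt i x))

_⊕_ : ∀ {n} → BVec n → BVec n → BVec n
(x ⊕ β) i = x i xor β i

weight : ∀ {n} → BVec n → ℕ
weight {n} β = sum (map (λ i → if β i then 1 else 0) (allFin n))

HasOrientation : ∀ {n} → BoolFun n → BVec n → Set
HasOrientation {n} g β =
  Σ (BoolFun (n + n)) λ h → Monotone h × ((x : BVec n) → g x ≡ h (x ++ (x ⊕ β)))

HasOrientationOfWeightAtMost : ℕ → ∀ {n} → BoolFun n → Set
HasOrientationOfWeightAtMost w {n} g =
  Σ (BVec n) λ β → (weight β Data.Nat.≤ w) × HasOrientation g β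

-- Circuits over n input variables with ¬ gates and ∧, ∨ gates of fan-in
-- one or two (represented in unfolded, tree form).
data Circuit (n : ℕ) : Set where
  var  : Fin n → Circuit n
  neg  : Circuit n → Circuit n
  and1 : Circuit n → Circuit n
  or1  : Circuit n → Circuit n
  and2 : Circuit n → Circuit n → Circuit n
  or2  : Circuit n → Circuit n → Circuit n

eval : ∀ {n} → Circuit n → BoolFun n
eval (var i)    x = x i
eval (neg c)    x = not (eval c x)
eval (and1 c)   x = eval c x
eval (or1 c)    x = eval c x
eval (and2 c d) x = eval c x Data.Bool.∧ eval d x
eval (or2 c d)  x = eval c x Data.Bool.∨ eval d x

depth : ∀ {n} → Circuit n → ℕ
depth (var i)    = 0
depth (neg c)    = suc (depth c)
depth (and1 c)   = suc (depth c)
depth (or1 c)    = suc (depth c)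
depth (and2 c d) = suc (depth c ⊔ depth d)
depth (or2 c d)  = suc (depth c ⊔ depth d)

Computes : ∀ {n} → Circuit n → BoolFun n → Set
Computes {n} C f = (x : BVec n) → eval C x ≡ f x

AllGates : ∀ {n} → (BoolFun n → Set) → Circuit n → Set
AllGates P (var i)      = ⊤
AllGates P C@(neg c)    = P (eval C) × AllGates P c
AllGates P C@(and1 c)   = P (eval C) × AllGates P c
AllGates P C@(or1 c)    = P (eval C) × AllGates P c
AllGates P C@(and2 c d) = P (eval C) × AllGates P c × AllGates P d
AllGates P C@(or2 c d)  = P (eval C) × AllGates P c × AllGates P d

data Protocol (n : ℕ) : Set where
  leaf  : Fin n → Protocol n
  alice : (BVec n → Bool) → Protocol n → Protocol n → Protocol n
  bob   : (BVec n → Bool) → Protocol n → Protocol n → Protocol n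

run : ∀ {n} → Protocol n → BVec n → BVec n → Fin n
run (leaf i)      x y = i
run (alice a p q) x y = if a x then run p x y else run q x y
run (bob b p q)   x y = if b y then run p x y else run q x y

cost : ∀ {n} → Protocol n → ℕ
cost (leaf i)      = 0
cost (alice a p q) = suc (cost p ⊔ cost q)
cost (bob b p q)   = suc (cost p ⊔ cost q)

SolvesKW⁺ : ∀ {n} → BoolFun n → Protocol n → Set
SolvesKW⁺ {n} f P = (x y : BVec n) → f x ≡ true → f y ≡ false →
  (x (run P x y) ≡ true) × (y (run P x y) ≡ false)

KW⁺≤ : ∀ {n} → BoolFun n → ℕ → Set
KW⁺≤ f k = Σ _ λ P → SolvesKW⁺ f P × (cost P Data.Nat.≤ k)

module Submission where

-- The protocol walks from the output of C towards an input.  At a gate G the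
-- players hold a ∈ G⁻¹(1) (Alice) and b ∈ G⁻¹(0) (Bob) which agree on the
-- orientation β of G; G is monotone along increasing steps that leave β
-- fixed ("monotone off β").  Let S be the union of the orientations of the
-- children of G (weight ≤ 2w).  Both players reveal their vectors on S
-- (2·|S| bits).  Either some i ∈ S has a_i = 1, b_i = 0 and the game is
-- solved, or a ≤ b on S; then Alice replaces her coordinates on S by Bob's,
-- obtaining z with a ≤ z agreeing with a on β, so G(z) = 1, and z agrees
-- with b on S.  One more bit selects a child still separating z from b
-- (a negation gate is impossible at this point), and the walk continues
-- there; answers for (z, b) are answers for (a, b).  Each gate costs
-- 2·2w + 1 bits.

open import Defs
open import Data.Bool using (Bool; true; false; not; _∧_; _∨_; _xor_; if_then_else_)
  renaming (_≤_ to _≤ᵇ_)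
open import Data.Bool.Base using (f≤t; b≤b)
open import Data.Bool.Properties
  using (∧-idem; ∧-conicalˡ; ∧-conicalʳ; ∨-conicalˡ; ∨-conicalʳ; ∨-zeroʳ; not-injective)
  renaming (_≟_ to _≟ᵇ_; ≤-minimum to false≤; ≤-maximum to ≤true; ≤-trans to ≤ᵇ-trans)
open import Data.Nat using (ℕ; suc; _+_; _*_; _⊔_; z≤n; s≤s) renaming (_≤_ to _≤ₙ_)
open import Data.Nat.Properties
  using (≤-refl; ≤-trans; n≤1+n; m≤m+n; ⊔-lub; m≤m⊔n; m≤n⊔m; *-monoˡ-≤; +-mono-≤; +-monoʳ-≤; +-suc)
open import Data.Nat.Solver using (module +-*-Solver)
open import Data.Fin using (Fin; _≟_; splitAt)
open import Data.Fin.Properties using (any?)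
open import Data.List using (List; []; _∷_; allFin; map)
open import Data.Nat.ListAction using (sum)
open import Data.List.Relation.Unary.Any using (here; there)
open import Data.List.Membership.Propositional using (_∈_)
open import Data.List.Membership.Propositional.Properties using (∈-allFin)
open import Data.Product using (_×_; _,_; ∃)
open import Data.Sum using (_⊎_; inj₁; inj₂)
open import Data.Empty using (⊥-elim)
open import Data.Vec.Functional using (_++_)
open import Function using (id)
open import Relation.Nullary using (¬_; Dec; yes; no)
open import Relation.Nullary.Decidable using (⌊_⌋; _×-dec_)
open import Relation.Binary.PropositionalEquality
  using (_≡_; refl; sym; trans; cong; subst)

≤-true : ∀ {p q} → p ≤ᵇ q → p ≡ true → q ≡ true
≤-true b≤b refl = refl

∧-≤ˡ : ∀ p q → p ∧ q ≤ᵇ p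
∧-≤ˡ false q = b≤b
∧-≤ˡ true  q = ≤true q

∧-≤ʳ : ∀ p q → p ∧ q ≤ᵇ q
∧-≤ʳ false q = false≤ q
∧-≤ʳ true  q = b≤b

true≢false : ¬ (true ≡ false)
true≢false ()

not-≤-reflect : ∀ {p q} → not p ≤ᵇ not q → q ≤ᵇ p
not-≤-reflect {false} {false} _ = b≤b
not-≤-reflect {true}  {false} _ = f≤t
not-≤-reflect {true}  {true}  _ = b≤b

xor-mono : ∀ {p q} c → p ≤ᵇ q → (c ≡ true → p ≡ q) → p xor c ≤ᵇ q xor c
xor-mono false f≤t _  = f≤t
xor-mono false b≤b _  = b≤b
xor-mono true  _   eq rewrite eq refl = b≤b

module _ {n : ℕ} where

  _≤ᵛ_ : BVec n → BVec n → Set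
  x ≤ᵛ y = ∀ i → x i ≤ᵇ y i

  -- Subsets of coordinates are characteristic vectors.
  ∅ : BVec n
  ∅ _ = false

  _∪_ : BVec n → BVec n → BVec n
  (S ∪ T) i = S i ∨ T i

  AgreeOn : BVec n → BVec n → BVec n → Set
  AgreeOn S x y = ∀ i → S i ≡ true → x i ≡ y i

  agreeOn-∪ˡ : ∀ {S T x y} → AgreeOn (S ∪ T) x y → AgreeOn S x y
  agreeOn-∪ˡ agree i Si = agree i (cong (_∨ _) Si)

  agreeOn-∪ʳ : ∀ {S T x y} → AgreeOn (S ∪ T) x y → AgreeOn T x y
  agreeOn-∪ʳ {S} agree i Ti = agree i (trans (cong (S i ∨_) Ti) (∨-zeroʳ (S i)))

  MonotoneOff : BVec n → BoolFun n → Set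
  MonotoneOff β g = ∀ x y → x ≤ᵛ y → AgreeOn β x y → g x ≤ᵇ g y

  -- A function with orientation β is monotone off β: if x ≤ y agree on β,
  -- then (x, x ⊕ β) ≤ (y, y ⊕ β) and the monotone h is applied to both.
  orientation⇒monotoneOff : ∀ {g β} → HasOrientation g β → MonotoneOff β g
  orientation⇒monotoneOff {g} {β} (h , h-mono , g≡h) x y x≤y agree
    rewrite g≡h x | g≡h y = h-mono (x ++ (x ⊕ β)) (y ++ (y ⊕ β)) doubled
    where
    doubled : ∀ j → (x ++ (x ⊕ β)) j ≤ᵇ (y ++ (y ⊕ β)) j
    doubled j with splitAt n j
    ... | inj₁ i = x≤y i
    ... | inj₂ i = xor-mono (β i) (x≤y i) (agree i)

  weightOn : BVec n → List (Fin n) → ℕ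
  weightOn S is = sum (map (λ i → if S i then 1 else 0) is)

  weightOn-∅ : ∀ is → weightOn ∅ is ≡ 0
  weightOn-∅ []       = refl
  weightOn-∅ (i ∷ is) = weightOn-∅ is

  weightOn-∪ : ∀ S T is → weightOn (S ∪ T) is ≤ₙ weightOn S is + weightOn T is
  weightOn-∪ S T []       = z≤n
  weightOn-∪ S T (i ∷ is) with S i | T i | weightOn-∪ S T is
  ... | true  | true  | ih = s≤s (≤-trans ih (+-monoʳ-≤ (weightOn S is) (n≤1+n _)))
  ... | true  | false | ih = s≤s ih
  ... | false | true  | ih rewrite +-suc (weightOn S is) (weightOn T is) = s≤s ih
  ... | false | false | ih = ih

  record Orientation (w : ℕ) (g : BoolFun n) : Set where
    field
      direction : BVec n
      light     : weight direction ≤ₙ w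
      monotone  : MonotoneOff direction g

  fromHasOrientation : ∀ {w g} → HasOrientationOfWeightAtMost w g → Orientation w g
  fromHasOrientation (β , light , β-orients) =
    record { direction = β ; light = light ; monotone = orientation⇒monotoneOff β-orients }

  outputOrientation : ∀ {w} (c : Circuit n) → AllGates (HasOrientationOfWeightAtMost w) c →
                      Orientation w (eval c)
  outputOrientation {w} (var i) _ =
    record { direction = ∅ ; light = subst (_≤ₙ w) (sym (weightOn-∅ (allFin n))) z≤n
           ; monotone = λ x y x≤y _ → x≤y i }
  outputOrientation (neg c)    (o , _) = fromHasOrientation o
  outputOrientation (and1 c)   (o , _) = fromHasOrientation o
  outputOrientation (or1 c)    (o , _) = fromHasOrientation o
  outputOrientation (and2 c d) (o , _) = fromHasOrientation o
  outputOrientation (or2 c d)  (o , _) = fromHasOrientation o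

  data Speaker : Set where
    Alice Bob : Speaker

  ask : Speaker → (BVec n → Bool) → Protocol n → Protocol n → Protocol n
  ask Alice = alice
  ask Bob   = bob

  inputOf : Speaker → BVec n → BVec n → BVec n
  inputOf Alice x y = x
  inputOf Bob   x y = y

  run-ask : ∀ s m p q x y →
            run (ask s m p q) x y ≡ (if m (inputOf s x y) then run p x y else run q x y)
  run-ask Alice m p q x y = refl
  run-ask Bob   m p q x y = refl

  cost-ask : ∀ s m p q → cost (ask s m p q) ≡ suc (cost p ⊔ cost q)
  cost-ask Alice m p q = refl
  cost-ask Bob   m p q = refl

  assign : BVec n → Fin n → Bool → BVec n
  assign acc i b j = if ⌊ j ≟ i ⌋ then b else acc j

  -- Speaker s announces the coordinates in S (among is) of its vector φ(input),
  -- recording them in acc; the continuation k receives the recorded vector.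
  reveal : Speaker → (BVec n → BVec n) → BVec n → List (Fin n) →
           (BVec n → Protocol n) → BVec n → Protocol n
  reveal s φ S []       k acc = k acc
  reveal s φ S (i ∷ is) k acc =
    if S i then ask s (λ x → φ x i) (reveal s φ S is k (assign acc i true))
                                    (reveal s φ S is k (assign acc i false))
           else reveal s φ S is k acc

  reveal-cost : ∀ s φ S is k c → (∀ u → cost (k u) ≤ₙ c) →
                ∀ acc → cost (reveal s φ S is k acc) ≤ₙ weightOn S is + c
  reveal-cost s φ S []       k c k≤c acc = k≤c acc
  reveal-cost s φ S (i ∷ is) k c k≤c acc with S i
  ... | false = reveal-cost s φ S is k c k≤c acc
  ... | true  rewrite cost-ask s (λ x → φ x i) (reveal s φ S is k (assign acc i true))
                                               (reveal s φ S is k (assign acc i false)) =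
    s≤s (⊔-lub (reveal-cost s φ S is k c k≤c _) (reveal-cost s φ S is k c k≤c _))

  Recorded : BVec n → List (Fin n) → BVec n → BVec n → Set
  Recorded S is acc v = ∀ j → S j ≡ true → j ∈ is ⊎ acc j ≡ v j

  recorded-assign : ∀ {S i is acc v b} → v i ≡ b →
                    Recorded S (i ∷ is) acc v → Recorded S is (assign acc i b) v
  recorded-assign {i = i} vi≡b rec j Sj with j ≟ i
  ... | yes refl = inj₂ (sym vi≡b)
  ... | no j≢i with rec j Sj
  ...   | inj₁ (here j≡i)    = ⊥-elim (j≢i j≡i)
  ...   | inj₁ (there j∈is)  = inj₁ j∈is
  ...   | inj₂ accj≡vj       = inj₂ accj≡vj

  recorded-skip : ∀ {S i is acc v} → S i ≡ false →
                  Recorded S (i ∷ is) acc v → Recorded S is acc v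
  recorded-skip Si≡false rec j Sj with rec j Sj
  ... | inj₁ (here refl)   = ⊥-elim (true≢false (trans (sym Sj) Si≡false))
  ... | inj₁ (there j∈is)  = inj₁ j∈is
  ... | inj₂ accj≡vj       = inj₂ accj≡vj

  reveal-run : ∀ s φ S is k acc x y → Recorded S is acc (φ (inputOf s x y)) →
               ∃ λ u → AgreeOn S u (φ (inputOf s x y)) × run (reveal s φ S is k acc) x y ≡ run (k u) x y
  reveal-run s φ S [] k acc x y rec = acc , done , refl
    where
    done : AgreeOn S acc (φ (inputOf s x y))
    done j Sj with rec j Sj
    ... | inj₁ ()
    ... | inj₂ accj≡vj = accj≡vj
  reveal-run s φ S (i ∷ is) k acc x y rec with S i in Si
  ... | false = reveal-run s φ S is k acc x y (recorded-skip Si rec)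
  ... | true rewrite run-ask s (λ x → φ x i) (reveal s φ S is k (assign acc i true))
                                             (reveal s φ S is k (assign acc i false)) x y
    with φ (inputOf s x y) i in vi
  ...   | true  = reveal-run s φ S is k (assign acc i true)  x y (recorded-assign vi rec)
  ...   | false = reveal-run s φ S is k (assign acc i false) x y (recorded-assign vi rec)

  revealAll : Speaker → (BVec n → BVec n) → BVec n → (BVec n → Protocol n) → Protocol n
  revealAll s φ S k = reveal s φ S (allFin n) k ∅

  revealAll-cost : ∀ s φ S k c → (∀ u → cost (k u) ≤ₙ c) → cost (revealAll s φ S k) ≤ₙ weight S + c
  revealAll-cost s φ S k c k≤c = reveal-cost s φ S (allFin n) k c k≤c ∅

  revealAll-run : ∀ s φ S k x y → ∃ λ u →
                  AgreeOn S u (φ (inputOf s x y)) × run (revealAll s φ S k) x y ≡ run (k u) x y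
  revealAll-run s φ S k x y = reveal-run s φ S (allFin n) k ∅ x y (λ j _ → inj₁ (∈-allFin j))

  Separates : BVec n → BVec n → Fin n → Set
  Separates a b i = a i ≡ true × b i ≡ false

  Witness : BVec n → BVec n → BVec n → Fin n → Set
  Witness S u v i = S i ≡ true × u i ≡ true × v i ≡ false

  witness? : ∀ S u v i → Dec (Witness S u v i)
  witness? S u v i = (S i ≟ᵇ true) ×-dec (u i ≟ᵇ true) ×-dec (v i ≟ᵇ false)

  answerOr : ∀ {S u v} → Dec (∃ (Witness S u v)) → Protocol n → Protocol n
  answerOr (yes (i , _)) p = leaf i
  answerOr (no _)        p = p

  settle : BVec n → BVec n → BVec n → Protocol n → Protocol n
  settle S u v p = answerOr (any? (witness? S u v)) p

  settle-cost : ∀ S u v p {c} → cost p ≤ₙ c → cost (settle S u v p) ≤ₙ c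
  settle-cost S u v p p≤c with any? (witness? S u v)
  ... | yes _ = z≤n
  ... | no _  = p≤c

  noWitness⇒≤ : ∀ {S u v a b} → AgreeOn S u a → AgreeOn S v b →
                ¬ ∃ (Witness S u v) → ∀ i → S i ≡ true → a i ≤ᵇ b i
  noWitness⇒≤ {a = a} {b} u≈a v≈b none i Si with a i in ai | b i in bi
  ... | false | _     = false≤ _
  ... | true  | true  = b≤b
  ... | true  | false = ⊥-elim (none (i , Si , trans (u≈a i Si) ai , trans (v≈b i Si) bi))

  settle-correct : ∀ {S u v a b p x y} → AgreeOn S u a → AgreeOn S v b →
                   ((∀ i → S i ≡ true → a i ≤ᵇ b i) → Separates a b (run p x y)) →
                   Separates a b (run (settle S u v p) x y)
  settle-correct {S} {u} {v} u≈a v≈b continue with any? (witness? S u v)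
  ... | yes (i , Si , ui , vi) = trans (sym (u≈a i Si)) ui , trans (sym (v≈b i Si)) vi
  ... | no none                = continue (noWitness⇒≤ u≈a v≈b none)

  overwrite : BVec n → BVec n → BVec n → BVec n
  overwrite S v a i = if S i then v i else a i

  overwrite-≥ : ∀ {S v a b} → AgreeOn S v b → (∀ i → S i ≡ true → a i ≤ᵇ b i) →
                a ≤ᵛ overwrite S v a
  overwrite-≥ {S} {v} {a} v≈b a≤b i with S i in Si
  ... | false = b≤b
  ... | true  = subst (a i ≤ᵇ_) (sym (v≈b i Si)) (a≤b i Si)

  overwrite-agreeˡ : ∀ {S β v a b} → AgreeOn S v b → AgreeOn β a b → AgreeOn β a (overwrite S v a)
  overwrite-agreeˡ {S} v≈b a≈b i βi with S i in Si
  ... | false = refl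
  ... | true  = trans (a≈b i βi) (sym (v≈b i Si))

  overwrite-agreeʳ : ∀ {S β v a b} → AgreeOn S v b → AgreeOn β a b → AgreeOn β (overwrite S v a) b
  overwrite-agreeʳ {S} v≈b a≈b i βi with S i in Si
  ... | false = a≈b i βi
  ... | true  = v≈b i Si

  overwrite-agreeS : ∀ {S v a b} → AgreeOn S v b → AgreeOn S (overwrite S v a) b
  overwrite-agreeS v≈b i Si rewrite Si = v≈b i Si

  -- On S the new vector equals b, so every answer lies outside S, where it equals a.
  overwrite-pullback : ∀ {S v a b i} → AgreeOn S v b →
                       Separates (overwrite S v a) b i → Separates a b i
  overwrite-pullback {S} {i = i} v≈b (zi , bi) with S i in Si
  ... | false = zi , bi
  ... | true  = ⊥-elim (true≢false (trans (sym zi) (trans (v≈b i Si) bi)))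

  -- What Alice's new vector z satisfies after an exchange on S at a gate G
  -- whose orientation is β, when Bob holds b.
  record Progress (S β : BVec n) (G : BoolFun n) (z b : BVec n) : Set where
    field
      accepts : G z ≡ true
      agreeβ  : AgreeOn β z b
      agreeS  : AgreeOn S z b

  -- The overwritten vector z ≥ a agrees with a on β, so G z ≥ G a = 1.
  exchange-progress : ∀ {S β G v a b} → MonotoneOff β G → G a ≡ true → AgreeOn β a b →
                      AgreeOn S v b → (∀ i → S i ≡ true → a i ≤ᵇ b i) →
                      Progress S β G (overwrite S v a) b
  exchange-progress {v = v} {a} G-mono Ga a≈b v≈b a≤b = record
    { accepts = ≤-true (G-mono a _ (overwrite-≥ v≈b a≤b) (overwrite-agreeˡ v≈b a≈b)) Ga
    ; agreeβ  = overwrite-agreeʳ v≈b a≈b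
    ; agreeS  = overwrite-agreeS v≈b }

  -- The exchange step: Alice holds φ x, Bob holds y; both reveal their
  -- vectors on S, then either answer or pass to next with Alice's vector
  -- overwritten on S by Bob's.
  exchange : BVec n → (BVec n → BVec n) → ((BVec n → BVec n) → Protocol n) → Protocol n
  exchange S φ next =
    revealAll Alice φ S λ u → revealAll Bob id S λ v →
    settle S u v (next (λ x → overwrite S v (φ x)))

  exchange-cost : ∀ S φ next c → (∀ φ' → cost (next φ') ≤ₙ c) →
                  cost (exchange S φ next) ≤ₙ weight S + (weight S + c)
  exchange-cost S φ next c next≤c =
    revealAll-cost Alice φ S _ _ λ u → revealAll-cost Bob id S _ c λ v →
    settle-cost S u v _ (next≤c _)

  exchange-correct : ∀ {S β G} φ next x y → MonotoneOff β G → G (φ x) ≡ true → AgreeOn β (φ x) y →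
    (∀ v → Progress S β G (overwrite S v (φ x)) y →
           Separates (overwrite S v (φ x)) y (run (next (λ x' → overwrite S v (φ x'))) x y)) →
    Separates (φ x) y (run (exchange S φ next) x y)
  exchange-correct {S} φ next x y G-mono Gφx φx≈y continue
    with revealAll-run Alice φ S (λ u → revealAll Bob id S λ v →
                                        settle S u v (next (λ x' → overwrite S v (φ x')))) x y
  ... | u , u≈a , run₁
    with revealAll-run Bob id S (λ v → settle S u v (next (λ x' → overwrite S v (φ x')))) x y
  ... | v , v≈b , run₂ =
    subst (Separates (φ x) y) (sym (trans run₁ run₂))
      (settle-correct u≈a v≈b λ a≤b →
        overwrite-pullback {a = φ x} v≈b (continue v (exchange-progress G-mono Gφx φx≈y v≈b a≤b)))

  -- If h is monotone off S and ¬h monotone off β, then h cannot increase from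
  -- z to y when these agree on S and β: compare both with the meet z ∧ y,
  -- which agrees with z on S and with y on β.
  negation-rigid : ∀ {S β} (h : BoolFun n) → MonotoneOff S h → MonotoneOff β (λ x → not (h x)) →
                   ∀ z y → AgreeOn S z y → AgreeOn β z y → h y ≤ᵇ h z
  negation-rigid {S} {β} h h-mono ¬h-mono z y z≈y-S z≈y-β =
    ≤ᵇ-trans (not-≤-reflect (¬h-mono m y (λ i → ∧-≤ʳ (z i) (y i)) m≈y))
             (h-mono m z (λ i → ∧-≤ˡ (z i) (y i)) m≈z)
    where
    m : BVec n
    m i = z i ∧ y i
    m≈z : AgreeOn S m z
    m≈z i Si = trans (cong (z i ∧_) (sym (z≈y-S i Si))) (∧-idem (z i))
    m≈y : AgreeOn β m y
    m≈y i βi = trans (cong (_∧ y i) (z≈y-β i βi)) (∧-idem (y i))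

module GateProtocol {n : ℕ} (w : ℕ) where

  Oriented : Circuit n → Set
  Oriented = AllGates (HasOrientationOfWeightAtMost w)

  dir : (c : Circuit n) → Oriented c → BVec n
  dir c oc = Orientation.direction (outputOrientation c oc)

  monotone : (c : Circuit n) (oc : Oriented c) → MonotoneOff (dir c oc) (eval c)
  monotone c oc = Orientation.monotone (outputOrientation c oc)

  -- At each gate: exchange on the orientations of the children, then move to
  -- a child (after a negation gate this continuation is never reached).
  protocol : (g : Circuit n) → Oriented g → (BVec n → BVec n) → Protocol n

  -- At an ∧-gate Bob says whether child a accepts his vector; if so, child b rejects it.
  andChoice : (a : Circuit n) → Oriented a → (b : Circuit n) → Oriented b →
              (BVec n → BVec n) → Protocol n
  andChoice a oa b ob φ = bob (eval a) (protocol b ob φ) (protocol a oa φ)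

  orChoice : (a : Circuit n) → Oriented a → (b : Circuit n) → Oriented b →
             (BVec n → BVec n) → Protocol n
  orChoice a oa b ob φ = alice (λ x → eval a (φ x)) (protocol a oa φ) (protocol b ob φ)

  protocol (var i)    _             φ = leaf i
  protocol (neg a)    (_ , oa)      φ = exchange (dir a oa) φ (protocol a oa)
  protocol (and1 a)   (_ , oa)      φ = exchange (dir a oa) φ (protocol a oa)
  protocol (or1 a)    (_ , oa)      φ = exchange (dir a oa) φ (protocol a oa)
  protocol (and2 a b) (_ , oa , ob) φ = exchange (dir a oa ∪ dir b ob) φ (andChoice a oa b ob)
  protocol (or2 a b)  (_ , oa , ob) φ = exchange (dir a oa ∪ dir b ob) φ (orChoice a oa b ob)

  protocol-correct : ∀ g og {β} → MonotoneOff β (eval g) → ∀ φ x y →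
                     eval g (φ x) ≡ true → eval g y ≡ false → AgreeOn β (φ x) y →
                     Separates (φ x) y (run (protocol g og φ) x y)
  protocol-correct (var i) _ _ φ x y gx gy _ = gx , gy
  protocol-correct (neg a) (_ , oa) g-mono φ x y gx gy φx≈y =
    exchange-correct φ (protocol a oa) x y g-mono gx φx≈y λ v pr →
      ⊥-elim (true≢false (trans (sym (≤-true (rigid v pr) ay)) (not-injective (accepts pr))))
    where
    open Progress
    ay : eval a y ≡ true
    ay = not-injective {y = true} gy
    rigid : ∀ v pr → eval a y ≤ᵇ eval a (overwrite (dir a oa) v (φ x))
    rigid v pr = negation-rigid (eval a) (monotone a oa) g-mono _ y (agreeS pr) (agreeβ pr)
  protocol-correct (and1 a) (_ , oa) g-mono φ x y gx gy φx≈y =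
    exchange-correct φ (protocol a oa) x y g-mono gx φx≈y λ v pr →
      protocol-correct a oa (monotone a oa) _ x y (Progress.accepts pr) gy (Progress.agreeS pr)
  protocol-correct (or1 a) (_ , oa) g-mono φ x y gx gy φx≈y =
    exchange-correct φ (protocol a oa) x y g-mono gx φx≈y λ v pr →
      protocol-correct a oa (monotone a oa) _ x y (Progress.accepts pr) gy (Progress.agreeS pr)
  protocol-correct (and2 a b) (_ , oa , ob) g-mono φ x y gx gy φx≈y =
    exchange-correct φ (andChoice a oa b ob) x y g-mono gx φx≈y λ v pr →
      bobChooses (λ x' → overwrite (dir a oa ∪ dir b ob) v (φ x'))
                 (Progress.accepts pr) gy (Progress.agreeS pr)
    where
    bobChooses : ∀ φ' → eval a (φ' x) ∧ eval b (φ' x) ≡ true → eval a y ∧ eval b y ≡ false →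
                 AgreeOn (dir a oa ∪ dir b ob) (φ' x) y →
                 Separates (φ' x) y (run (andChoice a oa b ob φ') x y)
    bobChooses φ' gz gy' agree with eval a y in ay
    ... | true  = protocol-correct b ob (monotone b ob) φ' x y
                    (∧-conicalʳ _ _ gz) gy' (agreeOn-∪ʳ agree)
    ... | false = protocol-correct a oa (monotone a oa) φ' x y
                    (∧-conicalˡ _ _ gz) ay (agreeOn-∪ˡ agree)
  protocol-correct (or2 a b) (_ , oa , ob) g-mono φ x y gx gy φx≈y =
    exchange-correct φ (orChoice a oa b ob) x y g-mono gx φx≈y λ v pr →
      aliceChooses (λ x' → overwrite (dir a oa ∪ dir b ob) v (φ x'))
                   (Progress.accepts pr) gy (Progress.agreeS pr)
    where
    aliceChooses : ∀ φ' → eval a (φ' x) ∨ eval b (φ' x) ≡ true → eval a y ∨ eval b y ≡ false →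
                   AgreeOn (dir a oa ∪ dir b ob) (φ' x) y →
                   Separates (φ' x) y (run (orChoice a oa b ob φ') x y)
    aliceChooses φ' gz gy' agree with eval a (φ' x) in az
    ... | true  = protocol-correct a oa (monotone a oa) φ' x y
                    az (∨-conicalˡ _ _ gy') (agreeOn-∪ˡ agree)
    ... | false = protocol-correct b ob (monotone b ob) φ' x y
                    gz (∨-conicalʳ _ _ gy') (agreeOn-∪ʳ agree)

  K : ℕ
  K = 4 * w + 1

  -- The exchanged set has weight ≤ 2w: w for one child, 2w by subadditivity for two.
  unary-light : ∀ a oa → weight (dir a oa) ≤ₙ w + w
  unary-light a oa = ≤-trans (Orientation.light (outputOrientation a oa)) (m≤m+n w w)

  binary-light : ∀ a oa b ob → weight (dir a oa ∪ dir b ob) ≤ₙ w + w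
  binary-light a oa b ob =
    ≤-trans (weightOn-∪ (dir a oa) (dir b ob) (allFin n))
            (+-mono-≤ (Orientation.light (outputOrientation a oa))
                      (Orientation.light (outputOrientation b ob)))

  -- An exchange on a set of weight ≤ 2w followed by a step of cost ≤ 1 + D·K
  -- costs at most (D + 1)·K, since 2w + (2w + 1 + D·K) = K + D·K.
  exchange-within : ∀ (S : BVec n) φ next D → weight S ≤ₙ w + w →
                    (∀ φ' → cost (next φ') ≤ₙ suc (D * K)) → cost (exchange S φ next) ≤ₙ suc D * K
  exchange-within S φ next D S-light next≤ =
    ≤-trans (exchange-cost S φ next _ next≤)
            (subst (weight S + (weight S + suc (D * K)) ≤ₙ_) (budget w (D * K))
                   (+-mono-≤ S-light (+-mono-≤ S-light ≤-refl)))
    where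
    open +-*-Solver
    budget : ∀ w r → (w + w) + ((w + w) + suc r) ≡ (4 * w + 1) + r
    budget = solve 2 (λ w r → (w :+ w) :+ ((w :+ w) :+ (con 1 :+ r))
                              := (con 4 :* w :+ con 1) :+ r) refl

  raise : ∀ {c D E} → c ≤ₙ D * K → D ≤ₙ E → c ≤ₙ E * K
  raise c≤DK D≤E = ≤-trans c≤DK (*-monoˡ-≤ K D≤E)

  unary-cost : ∀ a oa φ → (∀ φ' → cost (protocol a oa φ') ≤ₙ depth a * K) →
               cost (exchange (dir a oa) φ (protocol a oa)) ≤ₙ suc (depth a) * K
  unary-cost a oa φ child≤ =
    exchange-within (dir a oa) φ (protocol a oa) (depth a) (unary-light a oa)
                    (λ φ' → ≤-trans (child≤ φ') (n≤1+n _))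

  protocol-cost : ∀ g og φ → cost (protocol g og φ) ≤ₙ depth g * K
  protocol-cost (var i) _ φ = z≤n
  protocol-cost (neg a)  (_ , oa) φ = unary-cost a oa φ (protocol-cost a oa)
  protocol-cost (and1 a) (_ , oa) φ = unary-cost a oa φ (protocol-cost a oa)
  protocol-cost (or1 a)  (_ , oa) φ = unary-cost a oa φ (protocol-cost a oa)
  protocol-cost (and2 a b) (_ , oa , ob) φ =
    exchange-within (dir a oa ∪ dir b ob) φ (andChoice a oa b ob) (depth a ⊔ depth b)
                    (binary-light a oa b ob) λ φ' →
      s≤s (⊔-lub (raise (protocol-cost b ob φ') (m≤n⊔m (depth a) (depth b)))
                 (raise (protocol-cost a oa φ') (m≤m⊔n (depth a) (depth b))))
  protocol-cost (or2 a b) (_ , oa , ob) φ =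
    exchange-within (dir a oa ∪ dir b ob) φ (orChoice a oa b ob) (depth a ⊔ depth b)
                    (binary-light a oa b ob) λ φ' →
      s≤s (⊔-lub (raise (protocol-cost a oa φ') (m≤m⊔n (depth a) (depth b)))
                 (raise (protocol-cost b ob φ') (m≤n⊔m (depth a) (depth b))))

-- The theorem: run the gate protocol from the output of C with β = ∅,
-- which is legitimate because f, hence eval C, is monotone.
lemma1 : (n : ℕ) (f : BoolFun n) → Monotone f → ((i : Fin n) → SensitiveOn f i) →
         (w d : ℕ) (C : Circuit n) → Computes C f → depth C ≡ d →
         AllGates (HasOrientationOfWeightAtMost w) C →
         KW⁺≤ f (d * (4 * w + 1))
lemma1 n f f-mono _ w .(depth C) C C≡f refl oC = protocol C oC id , solves , protocol-cost C oC id
  where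
  open GateProtocol w
  C-mono : MonotoneOff ∅ (eval C)
  C-mono x y x≤y _ rewrite C≡f x | C≡f y = f-mono x y x≤y
  solves : SolvesKW⁺ f (protocol C oC id)
  solves x y fx fy =
    protocol-correct C oC C-mono id x y (trans (C≡f x) fx) (trans (C≡f y) fy) (λ i ())
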